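{- For every integer $n\ge 0$, let $\gamma=\psi_1\circ\psi_3^n\circ\psi_1$. Then $\Psi_\gamma=\psi_3\circ\psi_8^{\,n+1}$.
   Context: Morphisms of $\{0,1\}^*$: $\psi_1: 0\mapsto 01,\ 1\mapsto 0$; $\psi_3: 0\mapsto 0,\ 1\mapsto 01$; $\psi_8: 0\mapsto 01,\ 1\mapsto 1$. For a morphism $\gamma$ in the monoid generated by $\psi_1,\psi_3$ such that $\gamma(0)$ ends with $0$, write $\gamma(0)=u0$; $\Psi_\gamma$ denotes the morphism conjugate to $\gamma$ by $u$, i.e. the morphism with $u\,\Psi_\gamma(a)=\gamma(a)\,u$ for $a\in\{0,1\}$ (if $\gamma(1)=u0v$ then $\Psi_\gamma(0)=0u$, $\Psi_\gamma(1)=0vu$). -}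

module Defs where

open import Data.List using (List; []; _∷_; _++_; concatMap)
open import Data.Nat using (ℕ; zero; suc)
open import Data.Product using (Σ; _×_)
open import Relation.Binary.PropositionalEquality using (_≡_)

data Letter : Set where
  𝟘 𝟙 : Letter

Word : Set
Word = List Letter

Morphism : Set
Morphism = Letter → Word

apply : Morphism → Word → Word
apply f w = concatMap f w

_∘ₘ_ : Morphism → Morphism → Morphism
(f ∘ₘ g) a = apply f (g a)

idₘ : Morphism
idₘ a = a ∷ []

_^ₘ_ : Morphism → ℕ → Morphism
f ^ₘ zero = idₘ
f ^ₘ suc n = f ∘ₘ (f ^ₘ n)

ψ₁ : Morphism
ψ₁ 𝟘 = 𝟘 ∷ 𝟙 ∷ []
ψ₁ 𝟙 = 𝟘 ∷ []

ψ₃ : Morphism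
ψ₃ 𝟘 = 𝟘 ∷ []
ψ₃ 𝟙 = 𝟘 ∷ 𝟙 ∷ []

ψ₈ : Morphism
ψ₈ 𝟘 = 𝟘 ∷ 𝟙 ∷ []
ψ₈ 𝟙 = 𝟙 ∷ []

-- "Ψ is the morphism Ψ_γ": γ(0) = u0 for some word u, and Ψ is the
-- morphism conjugate to γ by u, i.e. u Ψ(a) = γ(a) u for every letter a.
-- (u is determined by γ, and Ψ by u, via cancellation in the free monoid.)
IsΨ : Morphism → Morphism → Set
IsΨ γ Ψ = Σ Word (λ u → (γ 𝟘 ≡ u ++ (𝟘 ∷ [])) × ((a : Letter) → u ++ Ψ a ≡ γ a ++ u))

module Submission where

-- Writing v^k for the k-th power
-- of a word v, the proof computes the four images explicitly:
--   γ(0) = (01)ⁿ⁺¹0,   γ(1) = 01,   Ψ(0) = 0(01)ⁿ⁺¹,   Ψ(1) = 01,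
-- so with u = (01)ⁿ⁺¹ we get γ(0) = u0, and the conjugacy equations
--   u·Ψ(0) = u0·u = γ(0)·u   and   u·01 = 01·u   (powers of 01 commute with 01).

open import Defs
open import Data.Nat using (ℕ; zero; suc)
open import Data.List using (List; []; _∷_; _++_; [_])
open import Data.List.Properties using (++-assoc; ++-identityʳ; concatMap-++)
open import Data.Product using (_,_)
open import Relation.Binary.PropositionalEquality
  using (_≡_; refl; trans; cong; cong₂)
open Relation.Binary.PropositionalEquality.≡-Reasoning

_^ʷ_ : Word → ℕ → Word
v ^ʷ zero = []
v ^ʷ suc k = v ++ v ^ʷ k

^ʷ-comm : (v : Word) (k : ℕ) → v ++ v ^ʷ k ≡ v ^ʷ k ++ v
^ʷ-comm v zero = ++-identityʳ v
^ʷ-comm v (suc k) = begin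
  v ++ (v ++ v ^ʷ k)  ≡⟨ cong (v ++_) (^ʷ-comm v k) ⟩
  v ++ (v ^ʷ k ++ v)  ≡⟨ ++-assoc v (v ^ʷ k) v ⟨
  (v ++ v ^ʷ k) ++ v  ∎

apply-[] : (f : Morphism) (a : Letter) → apply f [ a ] ≡ f a
apply-[] f a = ++-identityʳ (f a)

apply-^ʷ : (f : Morphism) (v : Word) (k : ℕ) → apply f (v ^ʷ k) ≡ apply f v ^ʷ k
apply-^ʷ f v zero = refl
apply-^ʷ f v (suc k) = begin
  apply f (v ++ v ^ʷ k)          ≡⟨ concatMap-++ f v (v ^ʷ k) ⟩
  apply f v ++ apply f (v ^ʷ k)  ≡⟨ cong (apply f v ++_) (apply-^ʷ f v k) ⟩
  apply f v ++ apply f v ^ʷ k    ∎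

apply-fixed : (f : Morphism) (c : Letter) → f c ≡ [ c ] →
              (k : ℕ) → apply f ([ c ] ^ʷ k) ≡ [ c ] ^ʷ k
apply-fixed f c fc k = trans (apply-^ʷ f [ c ] k)
                             (cong (_^ʷ k) (trans (apply-[] f c) fc))

power-fixed : (f : Morphism) (c : Letter) → f c ≡ [ c ] →
              (k : ℕ) → (f ^ₘ k) c ≡ [ c ]
power-fixed f c fc zero = refl
power-fixed f c fc (suc k) = begin
  apply f ((f ^ₘ k) c)  ≡⟨ cong (apply f) (power-fixed f c fc k) ⟩
  apply f [ c ]         ≡⟨ apply-[] f c ⟩
  f c                   ≡⟨ fc ⟩
  [ c ]                 ∎

power-append : (f : Morphism) (b c : Letter) → f b ≡ b ∷ [ c ] → f c ≡ [ c ] →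
               (k : ℕ) → (f ^ₘ k) b ≡ b ∷ [ c ] ^ʷ k
power-append f b c fb fc zero = refl
power-append f b c fb fc (suc k) = begin
  apply f ((f ^ₘ k) b)                ≡⟨ cong (apply f) (power-append f b c fb fc k) ⟩
  f b ++ apply f ([ c ] ^ʷ k)         ≡⟨ cong (f b ++_) (apply-fixed f c fc k) ⟩
  f b ++ [ c ] ^ʷ k                   ≡⟨ cong (_++ [ c ] ^ʷ k) fb ⟩
  b ∷ [ c ] ^ʷ suc k                  ∎

power-prepend : (f : Morphism) (b c : Letter) → f b ≡ c ∷ [ b ] → f c ≡ [ c ] →
                (k : ℕ) → (f ^ₘ k) b ≡ [ c ] ^ʷ k ++ [ b ]
power-prepend f b c fb fc zero = refl
power-prepend f b c fb fc (suc k) = begin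
  apply f ((f ^ₘ k) b)                         ≡⟨ cong (apply f) (power-prepend f b c fb fc k) ⟩
  apply f ([ c ] ^ʷ k ++ [ b ])                ≡⟨ concatMap-++ f ([ c ] ^ʷ k) [ b ] ⟩
  apply f ([ c ] ^ʷ k) ++ apply f [ b ]        ≡⟨ cong₂ _++_ (apply-fixed f c fc k) (trans (apply-[] f b) fb) ⟩
  [ c ] ^ʷ k ++ [ c ] ++ [ b ]                 ≡⟨ ++-assoc ([ c ] ^ʷ k) [ c ] [ b ] ⟨
  ([ c ] ^ʷ k ++ [ c ]) ++ [ b ]               ≡⟨ cong (_++ [ b ]) (^ʷ-comm [ c ] k) ⟨
  [ c ] ^ʷ suc k ++ [ b ]                      ∎

γ : ℕ → Morphism
γ n = ψ₁ ∘ₘ ((ψ₃ ^ₘ n) ∘ₘ ψ₁)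

Ψ : ℕ → Morphism
Ψ n = ψ₃ ∘ₘ (ψ₈ ^ₘ suc n)

u : ℕ → Word
u n = (𝟘 ∷ 𝟙 ∷ []) ^ʷ suc n

-- γ(0) = ψ₁(0·0ⁿ1) = (01)ⁿ⁺¹0, using ψ₃ⁿ(0) = 0 and ψ₃ⁿ(1) = 0ⁿ1.
γ-𝟘 : (n : ℕ) → γ n 𝟘 ≡ u n ++ [ 𝟘 ]
γ-𝟘 n = begin
  apply ψ₁ ((ψ₃ ^ₘ n) 𝟘 ++ (ψ₃ ^ₘ n) 𝟙 ++ [])
    ≡⟨ cong (λ t → apply ψ₁ ((ψ₃ ^ₘ n) 𝟘 ++ t)) (++-identityʳ ((ψ₃ ^ₘ n) 𝟙)) ⟩
  apply ψ₁ ((ψ₃ ^ₘ n) 𝟘 ++ (ψ₃ ^ₘ n) 𝟙)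
    ≡⟨ cong (λ t → apply ψ₁ (t ++ (ψ₃ ^ₘ n) 𝟙)) (power-fixed ψ₃ 𝟘 refl n) ⟩
  apply ψ₁ (𝟘 ∷ (ψ₃ ^ₘ n) 𝟙)
    ≡⟨ cong (λ t → apply ψ₁ (𝟘 ∷ t)) (power-prepend ψ₃ 𝟙 𝟘 refl refl n) ⟩
  𝟘 ∷ 𝟙 ∷ apply ψ₁ ([ 𝟘 ] ^ʷ n ++ [ 𝟙 ])
    ≡⟨ cong (λ t → 𝟘 ∷ 𝟙 ∷ t) (concatMap-++ ψ₁ ([ 𝟘 ] ^ʷ n) [ 𝟙 ]) ⟩
  𝟘 ∷ 𝟙 ∷ apply ψ₁ ([ 𝟘 ] ^ʷ n) ++ [ 𝟘 ]
    ≡⟨ cong (λ t → 𝟘 ∷ 𝟙 ∷ t ++ [ 𝟘 ]) (apply-^ʷ ψ₁ [ 𝟘 ] n) ⟩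
  u n ++ [ 𝟘 ]
    ∎

γ-𝟙 : (n : ℕ) → γ n 𝟙 ≡ 𝟘 ∷ 𝟙 ∷ []
γ-𝟙 n = begin
  apply ψ₁ ((ψ₃ ^ₘ n) 𝟘 ++ [])  ≡⟨ cong (apply ψ₁) (++-identityʳ ((ψ₃ ^ₘ n) 𝟘)) ⟩
  apply ψ₁ ((ψ₃ ^ₘ n) 𝟘)        ≡⟨ cong (apply ψ₁) (power-fixed ψ₃ 𝟘 refl n) ⟩
  𝟘 ∷ 𝟙 ∷ []                    ∎

-- Ψ(0) = ψ₃(0 1ⁿ⁺¹) = 0(01)ⁿ⁺¹, using ψ₈ⁿ⁺¹(0) = 01ⁿ⁺¹.
Ψ-𝟘 : (n : ℕ) → Ψ n 𝟘 ≡ 𝟘 ∷ u n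
Ψ-𝟘 n = begin
  apply ψ₃ ((ψ₈ ^ₘ suc n) 𝟘)      ≡⟨ cong (apply ψ₃) (power-append ψ₈ 𝟘 𝟙 refl refl (suc n)) ⟩
  𝟘 ∷ apply ψ₃ ([ 𝟙 ] ^ʷ suc n)   ≡⟨ cong (𝟘 ∷_) (apply-^ʷ ψ₃ [ 𝟙 ] (suc n)) ⟩
  𝟘 ∷ u n                         ∎

Ψ-𝟙 : (n : ℕ) → Ψ n 𝟙 ≡ 𝟘 ∷ 𝟙 ∷ []
Ψ-𝟙 n = cong (apply ψ₃) (power-fixed ψ₈ 𝟙 refl (suc n))

lemma4 : (n : ℕ) → IsΨ (ψ₁ ∘ₘ ((ψ₃ ^ₘ n) ∘ₘ ψ₁)) (ψ₃ ∘ₘ (ψ₈ ^ₘ suc n))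
lemma4 n = u n , γ-𝟘 n , conjugates
  where
  conjugates : (a : Letter) → u n ++ Ψ n a ≡ γ n a ++ u n
  conjugates 𝟘 = begin
    u n ++ Ψ n 𝟘          ≡⟨ cong (u n ++_) (Ψ-𝟘 n) ⟩
    u n ++ [ 𝟘 ] ++ u n   ≡⟨ ++-assoc (u n) [ 𝟘 ] (u n) ⟨
    (u n ++ [ 𝟘 ]) ++ u n ≡⟨ cong (_++ u n) (γ-𝟘 n) ⟨
    γ n 𝟘 ++ u n          ∎
  conjugates 𝟙 = begin
    u n ++ Ψ n 𝟙               ≡⟨ cong (u n ++_) (Ψ-𝟙 n) ⟩
    u n ++ 𝟘 ∷ 𝟙 ∷ []          ≡⟨ ^ʷ-comm (𝟘 ∷ 𝟙 ∷ []) (suc n) ⟨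
    𝟘 ∷ 𝟙 ∷ [] ++ u n          ≡⟨ cong (_++ u n) (γ-𝟙 n) ⟨
    γ n 𝟙 ++ u n               ∎
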